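{- Let $\Lambda=(\mathcal F,\mathcal V,\Theta,\Sigma,\mathcal R)$ be a $\lambda\Pi$-calculus satisfying the standing assumptions below. For every environment $\Gamma$, terms $t,T_1,\ldots,T_n,U,T$, distinct variables $x_1,\ldots,x_n$ and substitution $\sigma$ on $x_1,\ldots,x_n$, if $\Gamma\vdash t:\Pi x_1:T_1,\ldots,\Pi x_n:T_n,U$ and $\Gamma\vdash t\,(x_1\sigma)\ldots(x_n\sigma):T$, then $U\sigma\simeq T$ and $\Gamma\vdash\sigma:\Delta^n$, where $\Delta^n=x_1:T_1,\ldots,x_n:T_n$.
   Context: Sorts: $\mathcal S=\{\star,\Box\}$. Terms over function symbols $\mathcal F$ and variables $\mathcal V$: $t,u::=s\in\mathcal S\mid x\mid f\mid\lambda x:t,u\mid tu\mid\Pi x:t,u$, modulo renaming of bound variables. A $\lambda\Pi$-calculus $\Lambda=(\mathcal F,\mathcal V,\Theta,\Sigma,\mathcal R)$ consists of types $\Theta_f$, sorts $\Sigma_f\in\mathcal S$ of function symbols, and rewriting rules $l\hookrightarrow r$ with $\mathrm{FV}(r)\subseteq\mathrm{FV}(l)$. $\hookrightarrow_{\mathcal R}$ is the closure of $\mathcal R$ under contexts and substitutions, ${\hookrightarrow}={\hookrightarrow_{\mathcal R}}\cup{\hookrightarrow_\beta}$, and $\simeq$ is the smallest equivalence containing $\hookrightarrow$. Typing: (ax) $\vdash\star:\Box$; (fun) if $\vdash\Theta_f:\Sigma_f$ then $\vdash f:\Theta_f$; (var) if $\Gamma\vdash A:s$, $x\notin\Gamma$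 then $\Gamma,x:A\vdash x:A$; (weak) if $\Gamma\vdash t:T$, $\Gamma\vdash A:s$, $x\notin\Gamma$ then $\Gamma,x:A\vdash t:T$; (prod) if $\Gamma\vdash A:\star$, $\Gamma,x:A\vdash B:s$ then $\Gamma\vdash\Pi x:A,B:s$; (app) if $\Gamma\vdash t:\Pi x:A,B$, $\Gamma\vdash a:A$ then $\Gamma\vdash ta:B\{(x,a)\}$; (abs) if $\Gamma,x:A\vdash b:B$, $\Gamma\vdash\Pi x:A,B:s$ then $\Gamma\vdash\lambda x:A,b:\Pi x:A,B$; (conv) if $\Gamma\vdash t:T$, $\Gamma\vdash U:s$, $T\simeq U$ then $\Gamma\vdash t:U$. A substitution $\sigma$ is well-typed from $\Delta$ to $\Gamma$, written $\Gamma\vdash\sigma:\Delta$, if $\Gamma\vdash x\sigma:A\sigma$ for all $x:A\in\Delta$. Patterns: variables are split into algebraic and non-algebraic ones; a term is algebraic if it is an algebraic variable or $ft_1\ldots t_n$ with each $t_i$ algebraic and $\Theta_f$ of the form $\Pi x_1:A_1,\ldots,\Pi x_n:A_n,B$; object-level if all its symbols have sort $\star$; a pattern is $ft_1\ldots t_n$ with each $t_i$ object-level algebraic. Standing assumptions: (i) $\vdash\Theta_f:\Sigma_f$ for all $f$; (ii) $\hookrightarrow$ is confluent on untyped terms; (iii) all left-hand sides of $\mathcal R$ are patterns. -}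

module Defs where

open import Data.Nat using (ℕ; zero; suc)
open import Data.List using (List; []; _∷_; reverse)
open import Data.List.Relation.Unary.All using (All)
open import Data.Vec using (Vec; toList) renaming ([] to []ᵛ; _∷_ to _∷ᵛ_)
open import Data.Product using (Σ; ∃; _×_; _,_)
open import Data.Sum using (_⊎_)
open import Data.Unit using (⊤)
open import Data.Empty using (⊥)
open import Relation.Binary.PropositionalEquality using (_≡_)
open import Relation.Binary.Construct.Closure.ReflexiveTransitive using (Star)
open import Relation.Binary.Construct.Closure.Equivalence using (EqClosure)

data Sort : Set where
  star box : Sort

-- Terms over a set F of function symbols; variables are de Bruijn indices.
-- lam A b  is  λx:A,b   and   pi A B  is  Πx:A,B  (x bound as index 0).
data Term (F : Set) : Set where
  sort : Sort → Term F
  var  : ℕ → Term F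
  fun  : F → Term F
  lam  : Term F → Term F → Term F
  app  : Term F → Term F → Term F
  pi   : Term F → Term F → Term F

module _ {F : Set} where

  liftᵣ : (ℕ → ℕ) → ℕ → ℕ
  liftᵣ ρ zero    = zero
  liftᵣ ρ (suc n) = suc (ρ n)

  ren : (ℕ → ℕ) → Term F → Term F
  ren ρ (sort s)  = sort s
  ren ρ (var x)   = var (ρ x)
  ren ρ (fun f)   = fun f
  ren ρ (lam A b) = lam (ren ρ A) (ren (liftᵣ ρ) b)
  ren ρ (app t u) = app (ren ρ t) (ren ρ u)
  ren ρ (pi A B)  = pi (ren ρ A) (ren (liftᵣ ρ) B)

  shift : Term F → Term F
  shift = ren suc

  liftₛ : (ℕ → Term F) → ℕ → Term F
  liftₛ σ zero    = var zero
  liftₛ σ (suc n) = shift (σ n)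

  sub : (ℕ → Term F) → Term F → Term F
  sub σ (sort s)  = sort s
  sub σ (var x)   = σ x
  sub σ (fun f)   = fun f
  sub σ (lam A b) = lam (sub σ A) (sub (liftₛ σ) b)
  sub σ (app t u) = app (sub σ t) (sub σ u)
  sub σ (pi A B)  = pi (sub σ A) (sub (liftₛ σ) B)

  -- instantiation of the outermost bound variables: inst (aₖ ∷ … ∷ a₁ ∷ [])
  -- maps index 0 to aₖ, …, index k-1 to a₁, and index k+j to var j.
  inst : List (Term F) → ℕ → Term F
  inst []       n       = var n
  inst (a ∷ as) zero    = a
  inst (a ∷ as) (suc n) = inst as n

  _[0≔_] : Term F → Term F → Term F
  B [0≔ a ] = sub (inst (a ∷ [])) B

  Pis : ∀ {n} → Vec (Term F) n → Term F → Term F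
  Pis []ᵛ       U = U
  Pis (T ∷ᵛ Ts) U = pi T (Pis Ts U)

  apps : Term F → List (Term F) → Term F
  apps t []       = t
  apps t (a ∷ as) = apps (app t a) as

  _∈FV_ : ℕ → Term F → Set
  x ∈FV sort s  = ⊥
  x ∈FV var y   = x ≡ y
  x ∈FV fun f   = ⊥
  x ∈FV lam A b = x ∈FV A ⊎ suc x ∈FV b
  x ∈FV app t u = x ∈FV t ⊎ x ∈FV u
  x ∈FV pi A B  = x ∈FV A ⊎ suc x ∈FV B

  _∈Sym_ : F → Term F → Set
  f ∈Sym sort s  = ⊥
  f ∈Sym var y   = ⊥
  f ∈Sym fun g   = f ≡ g
  f ∈Sym lam A b = f ∈Sym A ⊎ f ∈Sym b
  f ∈Sym app t u = f ∈Sym t ⊎ f ∈Sym u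
  f ∈Sym pi A B  = f ∈Sym A ⊎ f ∈Sym B

  HasPis : ℕ → Term F → Set
  HasPis zero    T        = ⊤
  HasPis (suc n) (pi A B) = HasPis n B
  HasPis (suc n) _        = ⊥

-- λΠ-calculi Λ = (F, V, Θ, Σ, R), with V = ℕ (de Bruijn)

record Calculus : Set₁ where
  field
    F     : Set
    Θ     : F → Term F
    Σₛ    : F → Sort
    Rules : Term F → Term F → Set
    rulesFV : ∀ {l r} → Rules l r → ∀ x → x ∈FV r → x ∈FV l
    AlgVar : ℕ → Set

module Typing (Λ : Calculus) where
  open Calculus Λ

  Tm : Set
  Tm = Term F

  ⋆ □ : Tm
  ⋆ = sort star
  □ = sort box

  data _↪_ : Tm → Tm → Set where
    rule  : ∀ {l r} → Rules l r → (σ : ℕ → Tm) → sub σ l ↪ sub σ r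
    beta  : ∀ A b a → app (lam A b) a ↪ (b [0≔ a ])
    lamₗ  : ∀ {A A'} b → A ↪ A' → lam A b ↪ lam A' b
    lamᵣ  : ∀ A {b b'} → b ↪ b' → lam A b ↪ lam A b'
    appₗ  : ∀ {t t'} u → t ↪ t' → app t u ↪ app t' u
    appᵣ  : ∀ t {u u'} → u ↪ u' → app t u ↪ app t u'
    piₗ   : ∀ {A A'} B → A ↪ A' → pi A B ↪ pi A' B
    piᵣ   : ∀ A {B B'} → B ↪ B' → pi A B ↪ pi A B'

  _↪*_ : Tm → Tm → Set
  _↪*_ = Star _↪_

  infix 4 _≃_
  _≃_ : Tm → Tm → Set
  _≃_ = EqClosure _↪_

  Confluent : Set
  Confluent = ∀ {t u v} → t ↪* u → t ↪* v → ∃ λ w → (u ↪* w) × (v ↪* w)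

  data Algebraic : Tm → Set where
    avar : ∀ {x} → AlgVar x → Algebraic (var x)
    afun : ∀ f (ts : List Tm) → HasPis (Data.List.length ts) (Θ f) →
           All Algebraic ts → Algebraic (apps (fun f) ts)

  ObjectLevel : Tm → Set
  ObjectLevel t = ∀ f → f ∈Sym t → Σₛ f ≡ star

  Pattern : Tm → Set
  Pattern l = Σ F λ f → Σ (List Tm) λ ts →
    (l ≡ apps (fun f) ts) × All (λ t → ObjectLevel t × Algebraic t) ts

  -- typing environments: list of types, head = most recently bound variable
  Ctx : Set
  Ctx = List Tm

  infix 4 _⊢_∶_
  data _⊢_∶_ : Ctx → Tm → Tm → Set where
    ax   : [] ⊢ ⋆ ∶ □
    fun  : ∀ f → [] ⊢ Θ f ∶ sort (Σₛ f) → [] ⊢ fun f ∶ Θ f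
    var  : ∀ {Γ A s} → Γ ⊢ A ∶ sort s → (A ∷ Γ) ⊢ var zero ∶ shift A
    weak : ∀ {Γ t T A s} → Γ ⊢ t ∶ T → Γ ⊢ A ∶ sort s → (A ∷ Γ) ⊢ shift t ∶ shift T
    prod : ∀ {Γ A B s} → Γ ⊢ A ∶ ⋆ → (A ∷ Γ) ⊢ B ∶ sort s → Γ ⊢ pi A B ∶ sort s
    appl : ∀ {Γ t a A B} → Γ ⊢ t ∶ pi A B → Γ ⊢ a ∶ A → Γ ⊢ app t a ∶ (B [0≔ a ])
    abs  : ∀ {Γ A b B s} → (A ∷ Γ) ⊢ b ∶ B → Γ ⊢ pi A B ∶ sort s → Γ ⊢ lam A b ∶ pi A B
    conv : ∀ {Γ t T U s} → Γ ⊢ t ∶ T → Γ ⊢ U ∶ sort s → T ≃ U → Γ ⊢ t ∶ U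

  -- Standing assumptions (i)–(iii)
  record Assumptions : Set where
    field
      wfSig     : ∀ f → [] ⊢ Θ f ∶ sort (Σₛ f)
      confluent : Confluent
      lhsPat    : ∀ {l r} → Rules l r → Pattern l

  -- Γ ⊢ σ : Δⁿ for σ = {x₁ ↦ a₁, …, xₙ ↦ aₙ} and Δⁿ = x₁:T₁, …, xₙ:Tₙ :
  -- Γ ⊢ aᵢ : Tᵢσ for every i, where Tᵢ (under i-1 binders) is instantiated
  -- by a₁ … aᵢ₋₁ (acc holds the already-processed aⱼ, most recent first).
  WtSubAux : ∀ {n} → Ctx → List Tm → Vec Tm n → Vec Tm n → Set
  WtSubAux Γ acc []ᵛ       []ᵛ       = ⊤
  WtSubAux Γ acc (a ∷ᵛ as) (T ∷ᵛ Ts) = (Γ ⊢ a ∶ sub (inst acc) T) × WtSubAux Γ (a ∷ acc) as Ts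

  _⊢ˢ_∶_ : ∀ {n} → Ctx → Vec Tm n → Vec Tm n → Set
  Γ ⊢ˢ as ∶ Ts = WtSubAux Γ [] as Ts

  infix 30 _[_]ⁿ
  _[_]ⁿ : ∀ {n} → Tm → Vec Tm n → Tm
  U [ as ]ⁿ = sub (inst (reverse (toList as))) U

-- Feed the arguments to t one at a time.  Inverting the application rule,
-- t a₁ … aᵢ₋₁ has some product type Π x:A, B with aᵢ : A.  Types are unique
-- up to ≃ and products are injective for ≃ (by confluence, since no instance
-- of a pattern is a product), so A ≃ Tᵢ{x₁ ↦ a₁, …}, and by validity aᵢ can
-- be converted to that type.  Uniqueness of types for t a₁ … aₙ finally
-- gives Uσ ≃ T.
module Submission where

open import Defs
open import Data.Nat using (ℕ; zero; suc; _<_; z<s; s<s)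
open import Data.Vec using (Vec; toList) renaming ([] to []ᵛ; _∷_ to _∷ᵛ_)
open import Data.List using ([]; _∷_; reverseAcc; length; map)
open import Data.Product using (∃; ∃₂; _×_; _,_; proj₁; proj₂)
open import Data.Sum using (_⊎_; inj₁; inj₂)
open import Data.Empty using (⊥; ⊥-elim)
open import Data.Unit using (tt)
open import Function using (_∘_)
open import Relation.Binary.PropositionalEquality
open import Relation.Binary.Construct.Closure.ReflexiveTransitive using (ε; _◅_; _◅◅_)
open import Relation.Binary.Construct.Closure.Symmetric using (fwd; bwd)
open import Relation.Binary.Construct.Closure.Equivalence using (gmap; symmetric)
open import Relation.Binary.Construct.Closure.Equivalence.Properties using (a—↠b⇒a↔b; a—↠b⇒b↔a)

module _ {F : Set} where

  liftᵣ-cong : ∀ {ρ ρ′} → (∀ x → ρ x ≡ ρ′ x) → ∀ x → liftᵣ {F} ρ x ≡ liftᵣ {F} ρ′ x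
  liftᵣ-cong h zero    = refl
  liftᵣ-cong h (suc x) = cong suc (h x)

  ren-cong : ∀ {ρ ρ′} → (∀ x → ρ x ≡ ρ′ x) → (t : Term F) → ren ρ t ≡ ren ρ′ t
  ren-cong h (sort s)  = refl
  ren-cong h (var x)   = cong var (h x)
  ren-cong h (fun f)   = refl
  ren-cong h (lam A b) = cong₂ lam (ren-cong h A) (ren-cong (liftᵣ-cong h) b)
  ren-cong h (app t u) = cong₂ app (ren-cong h t) (ren-cong h u)
  ren-cong h (pi A B)  = cong₂ pi (ren-cong h A) (ren-cong (liftᵣ-cong h) B)

  liftₛ-cong : ∀ {σ σ′ : ℕ → Term F} → (∀ x → σ x ≡ σ′ x) → ∀ x → liftₛ σ x ≡ liftₛ σ′ x
  liftₛ-cong h zero    = refl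
  liftₛ-cong h (suc x) = cong shift (h x)

  sub-cong : ∀ {σ σ′} → (∀ x → σ x ≡ σ′ x) → (t : Term F) → sub σ t ≡ sub σ′ t
  sub-cong h (sort s)  = refl
  sub-cong h (var x)   = h x
  sub-cong h (fun f)   = refl
  sub-cong h (lam A b) = cong₂ lam (sub-cong h A) (sub-cong (liftₛ-cong h) b)
  sub-cong h (app t u) = cong₂ app (sub-cong h t) (sub-cong h u)
  sub-cong h (pi A B)  = cong₂ pi (sub-cong h A) (sub-cong (liftₛ-cong h) B)

  liftᵣ-∘ : ∀ ρ ρ′ x → liftᵣ {F} ρ′ (liftᵣ {F} ρ x) ≡ liftᵣ {F} (ρ′ ∘ ρ) x
  liftᵣ-∘ ρ ρ′ zero    = refl
  liftᵣ-∘ ρ ρ′ (suc x) = refl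

  ren-∘ : ∀ ρ ρ′ (t : Term F) → ren ρ′ (ren ρ t) ≡ ren (ρ′ ∘ ρ) t
  ren-∘ ρ ρ′ (sort s)  = refl
  ren-∘ ρ ρ′ (var x)   = refl
  ren-∘ ρ ρ′ (fun f)   = refl
  ren-∘ ρ ρ′ (lam A b) = cong₂ lam (ren-∘ ρ ρ′ A)
    (trans (ren-∘ (liftᵣ {F} ρ) (liftᵣ {F} ρ′) b) (ren-cong (liftᵣ-∘ ρ ρ′) b))
  ren-∘ ρ ρ′ (app t u) = cong₂ app (ren-∘ ρ ρ′ t) (ren-∘ ρ ρ′ u)
  ren-∘ ρ ρ′ (pi A B)  = cong₂ pi (ren-∘ ρ ρ′ A)
    (trans (ren-∘ (liftᵣ {F} ρ) (liftᵣ {F} ρ′) B) (ren-cong (liftᵣ-∘ ρ ρ′) B))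

  liftₛ-liftᵣ : ∀ ρ (σ : ℕ → Term F) x → liftₛ σ (liftᵣ {F} ρ x) ≡ liftₛ (σ ∘ ρ) x
  liftₛ-liftᵣ ρ σ zero    = refl
  liftₛ-liftᵣ ρ σ (suc x) = refl

  sub-ren : ∀ ρ σ (t : Term F) → sub σ (ren ρ t) ≡ sub (σ ∘ ρ) t
  sub-ren ρ σ (sort s)  = refl
  sub-ren ρ σ (var x)   = refl
  sub-ren ρ σ (fun f)   = refl
  sub-ren ρ σ (lam A b) = cong₂ lam (sub-ren ρ σ A)
    (trans (sub-ren (liftᵣ {F} ρ) (liftₛ σ) b) (sub-cong (liftₛ-liftᵣ ρ σ) b))
  sub-ren ρ σ (app t u) = cong₂ app (sub-ren ρ σ t) (sub-ren ρ σ u)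
  sub-ren ρ σ (pi A B)  = cong₂ pi (sub-ren ρ σ A)
    (trans (sub-ren (liftᵣ {F} ρ) (liftₛ σ) B) (sub-cong (liftₛ-liftᵣ ρ σ) B))

  liftᵣ-liftₛ : ∀ ρ (σ : ℕ → Term F) x → ren (liftᵣ {F} ρ) (liftₛ σ x) ≡ liftₛ (ren ρ ∘ σ) x
  liftᵣ-liftₛ ρ σ zero    = refl
  liftᵣ-liftₛ ρ σ (suc x) = trans (ren-∘ suc (liftᵣ {F} ρ) (σ x)) (sym (ren-∘ ρ suc (σ x)))

  ren-sub : ∀ ρ σ (t : Term F) → ren ρ (sub σ t) ≡ sub (ren ρ ∘ σ) t
  ren-sub ρ σ (sort s)  = refl
  ren-sub ρ σ (var x)   = refl
  ren-sub ρ σ (fun f)   = refl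
  ren-sub ρ σ (lam A b) = cong₂ lam (ren-sub ρ σ A)
    (trans (ren-sub (liftᵣ {F} ρ) (liftₛ σ) b) (sub-cong (liftᵣ-liftₛ ρ σ) b))
  ren-sub ρ σ (app t u) = cong₂ app (ren-sub ρ σ t) (ren-sub ρ σ u)
  ren-sub ρ σ (pi A B)  = cong₂ pi (ren-sub ρ σ A)
    (trans (ren-sub (liftᵣ {F} ρ) (liftₛ σ) B) (sub-cong (liftᵣ-liftₛ ρ σ) B))

  liftₛ-shift : ∀ σ (t : Term F) → sub (liftₛ σ) (shift t) ≡ shift (sub σ t)
  liftₛ-shift σ t = trans (sub-ren suc (liftₛ σ) t) (sym (ren-sub suc σ t))

  liftₛ-∘ : ∀ (σ τ : ℕ → Term F) x → sub (liftₛ τ) (liftₛ σ x) ≡ liftₛ (sub τ ∘ σ) x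
  liftₛ-∘ σ τ zero    = refl
  liftₛ-∘ σ τ (suc x) = liftₛ-shift τ (σ x)

  sub-∘ : ∀ σ τ (t : Term F) → sub τ (sub σ t) ≡ sub (sub τ ∘ σ) t
  sub-∘ σ τ (sort s)  = refl
  sub-∘ σ τ (var x)   = refl
  sub-∘ σ τ (fun f)   = refl
  sub-∘ σ τ (lam A b) = cong₂ lam (sub-∘ σ τ A)
    (trans (sub-∘ (liftₛ σ) (liftₛ τ) b) (sub-cong (liftₛ-∘ σ τ) b))
  sub-∘ σ τ (app t u) = cong₂ app (sub-∘ σ τ t) (sub-∘ σ τ u)
  sub-∘ σ τ (pi A B)  = cong₂ pi (sub-∘ σ τ A)
    (trans (sub-∘ (liftₛ σ) (liftₛ τ) B) (sub-cong (liftₛ-∘ σ τ) B))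

  liftₛ-var : ∀ x → liftₛ {F} var x ≡ var x
  liftₛ-var zero    = refl
  liftₛ-var (suc x) = refl

  sub-var : (t : Term F) → sub var t ≡ t
  sub-var (sort s)  = refl
  sub-var (var x)   = refl
  sub-var (fun f)   = refl
  sub-var (lam A b) = cong₂ lam (sub-var A) (trans (sub-cong liftₛ-var b) (sub-var b))
  sub-var (app t u) = cong₂ app (sub-var t) (sub-var u)
  sub-var (pi A B)  = cong₂ pi (sub-var A) (trans (sub-cong liftₛ-var B) (sub-var B))

  liftᵣ-as-liftₛ : ∀ ρ x → var {F} (liftᵣ {F} ρ x) ≡ liftₛ (var ∘ ρ) x
  liftᵣ-as-liftₛ ρ zero    = refl
  liftᵣ-as-liftₛ ρ (suc x) = refl

  ren-as-sub : ∀ ρ (t : Term F) → ren ρ t ≡ sub (var ∘ ρ) t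
  ren-as-sub ρ (sort s)  = refl
  ren-as-sub ρ (var x)   = refl
  ren-as-sub ρ (fun f)   = refl
  ren-as-sub ρ (lam A b) = cong₂ lam (ren-as-sub ρ A)
    (trans (ren-as-sub (liftᵣ {F} ρ) b) (sub-cong (liftᵣ-as-liftₛ ρ) b))
  ren-as-sub ρ (app t u) = cong₂ app (ren-as-sub ρ t) (ren-as-sub ρ u)
  ren-as-sub ρ (pi A B)  = cong₂ pi (ren-as-sub ρ A)
    (trans (ren-as-sub (liftᵣ {F} ρ) B) (sub-cong (liftᵣ-as-liftₛ ρ) B))

  liftᵣ-ren-as-sub : ∀ ρ (t : Term F) → ren (liftᵣ {F} ρ) t ≡ sub (liftₛ (var ∘ ρ)) t
  liftᵣ-ren-as-sub ρ t = trans (ren-as-sub (liftᵣ {F} ρ) t) (sub-cong (liftᵣ-as-liftₛ ρ) t)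

  [0≔]-shift : ∀ (a t : Term F) → shift t [0≔ a ] ≡ t
  [0≔]-shift a t = trans (sub-ren suc (inst (a ∷ [])) t) (sub-var t)

  sub-[0≔] : ∀ σ (b a : Term F) → sub σ (b [0≔ a ]) ≡ sub (liftₛ σ) b [0≔ sub σ a ]
  sub-[0≔] σ b a = trans (sub-∘ (inst (a ∷ [])) σ b)
    (trans (sub-cong commute b) (sym (sub-∘ (liftₛ σ) (inst (sub σ a ∷ [])) b)))
    where
      commute : ∀ x → sub σ (inst (a ∷ []) x) ≡ liftₛ σ x [0≔ sub σ a ]
      commute zero    = refl
      commute (suc x) = sym ([0≔]-shift (sub σ a) (σ x))

  shift-[0≔] : ∀ (b a : Term F) → shift (b [0≔ a ]) ≡ ren (liftᵣ {F} suc) b [0≔ shift a ]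
  shift-[0≔] b a = begin
    shift (b [0≔ a ])                                 ≡⟨ ren-as-sub suc (b [0≔ a ]) ⟩
    sub (var ∘ suc) (b [0≔ a ])                        ≡⟨ sub-[0≔] (var ∘ suc) b a ⟩
    sub (liftₛ (var ∘ suc)) b [0≔ sub (var ∘ suc) a ]  ≡⟨ cong₂ _[0≔_] (sym (liftᵣ-ren-as-sub suc b))
                                                                     (sym (ren-as-sub suc a)) ⟩
    ren (liftᵣ {F} suc) b [0≔ shift a ]                ∎
    where open ≡-Reasoning

  liftₛ-inst-[0≔] : ∀ (a : Term F) acc B → sub (liftₛ (inst acc)) B [0≔ a ] ≡ sub (inst (a ∷ acc)) B
  liftₛ-inst-[0≔] a acc B = trans (sub-∘ (liftₛ (inst acc)) (inst (a ∷ [])) B) (sub-cong fuse B)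
    where
      fuse : ∀ x → liftₛ (inst acc) x [0≔ a ] ≡ inst (a ∷ acc) x
      fuse zero    = refl
      fuse (suc x) = [0≔]-shift a (inst acc x)

  sub-apps : ∀ σ (h : Term F) ts → sub σ (apps h ts) ≡ apps (sub σ h) (map (sub σ) ts)
  sub-apps σ h []       = refl
  sub-apps σ h (t ∷ ts) = sub-apps σ (app h t) ts

  apps-≢pi : ∀ {h : Term F} → (∀ {A B} → h ≢ pi A B) → ∀ ts {A B} → apps h ts ≢ pi A B
  apps-≢pi h≢pi []       = h≢pi
  apps-≢pi h≢pi (t ∷ ts) = apps-≢pi (λ ()) ts

  data Scoped (n : ℕ) : Term F → Set where
    sort : ∀ s → Scoped n (sort s)
    var  : ∀ {x} → x < n → Scoped n (var x)
    fun  : ∀ f → Scoped n (fun f)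
    lam  : ∀ {A b} → Scoped n A → Scoped (suc n) b → Scoped n (lam A b)
    app  : ∀ {t u} → Scoped n t → Scoped n u → Scoped n (app t u)
    pi   : ∀ {A B} → Scoped n A → Scoped (suc n) B → Scoped n (pi A B)

  liftᵣ-< : ∀ {n m ρ} → (∀ {x} → x < n → ρ x < m) → ∀ {x} → x < suc n → liftᵣ {F} ρ x < suc m
  liftᵣ-< h {zero}  p       = z<s
  liftᵣ-< h {suc x} (s<s p) = s<s (h p)

  ren-scoped : ∀ {n m ρ t} → (∀ {x} → x < n → ρ x < m) → Scoped n t → Scoped m (ren ρ t)
  ren-scoped h (sort s)  = sort s
  ren-scoped h (var p)   = var (h p)
  ren-scoped h (fun f)   = fun f
  ren-scoped h (lam A b) = lam (ren-scoped h A) (ren-scoped (liftᵣ-< h) b)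
  ren-scoped h (app t u) = app (ren-scoped h t) (ren-scoped h u)
  ren-scoped h (pi A B)  = pi (ren-scoped h A) (ren-scoped (liftᵣ-< h) B)

  liftₛ-scoped : ∀ {n m σ} → (∀ {x} → x < n → Scoped m (σ x)) →
                 ∀ {x} → x < suc n → Scoped (suc m) (liftₛ σ x)
  liftₛ-scoped h {zero}  p       = var z<s
  liftₛ-scoped h {suc x} (s<s p) = ren-scoped s<s (h p)

  sub-scoped : ∀ {n m σ t} → (∀ {x} → x < n → Scoped m (σ x)) → Scoped n t → Scoped m (sub σ t)
  sub-scoped h (sort s)  = sort s
  sub-scoped h (var p)   = h p
  sub-scoped h (fun f)   = fun f
  sub-scoped h (lam A b) = lam (sub-scoped h A) (sub-scoped (liftₛ-scoped h) b)
  sub-scoped h (app t u) = app (sub-scoped h t) (sub-scoped h u)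
  sub-scoped h (pi A B)  = pi (sub-scoped h A) (sub-scoped (liftₛ-scoped h) B)

  liftₛ-var-below : ∀ {n} {σ : ℕ → Term F} → (∀ {x} → x < n → σ x ≡ var x) → ∀ {x} → x < suc n → liftₛ σ x ≡ var x
  liftₛ-var-below h {zero}  p       = refl
  liftₛ-var-below h {suc x} (s<s p) = cong shift (h p)

  sub-scoped-var : ∀ {n σ t} → (∀ {x} → x < n → σ x ≡ var x) → Scoped n t → sub σ t ≡ t
  sub-scoped-var h (sort s)  = refl
  sub-scoped-var h (var p)   = h p
  sub-scoped-var h (fun f)   = refl
  sub-scoped-var h (lam A b) = cong₂ lam (sub-scoped-var h A) (sub-scoped-var (liftₛ-var-below h) b)
  sub-scoped-var h (app t u) = cong₂ app (sub-scoped-var h t) (sub-scoped-var h u)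
  sub-scoped-var h (pi A B)  = cong₂ pi (sub-scoped-var h A) (sub-scoped-var (liftₛ-var-below h) B)

  sub-closed : ∀ {σ t} → Scoped 0 t → sub σ t ≡ t
  sub-closed = sub-scoped-var (λ ())

  shift-closed : ∀ {t} → Scoped 0 t → shift t ≡ t
  shift-closed {t} c = trans (ren-as-sub suc t) (sub-closed c)

module _ (Λ : Calculus) where
  open Calculus Λ
  open Typing Λ

  sub-↪ : ∀ σ {t u} → t ↪ u → sub σ t ↪ sub σ u
  sub-↪ σ (rule {l} {r} lr τ) =
    subst₂ _↪_ (sym (sub-∘ τ σ l)) (sym (sub-∘ τ σ r)) (rule lr (sub σ ∘ τ))
  sub-↪ σ (beta A b a) =
    subst (app (lam (sub σ A) (sub (liftₛ σ) b)) (sub σ a) ↪_) (sym (sub-[0≔] σ b a))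
          (beta (sub σ A) (sub (liftₛ σ) b) (sub σ a))
  sub-↪ σ (lamₗ b s) = lamₗ _ (sub-↪ σ s)
  sub-↪ σ (lamᵣ A s) = lamᵣ _ (sub-↪ (liftₛ σ) s)
  sub-↪ σ (appₗ u s) = appₗ _ (sub-↪ σ s)
  sub-↪ σ (appᵣ t s) = appᵣ _ (sub-↪ σ s)
  sub-↪ σ (piₗ B s)  = piₗ _ (sub-↪ σ s)
  sub-↪ σ (piᵣ A s)  = piᵣ _ (sub-↪ (liftₛ σ) s)

  sub-≃ : ∀ σ {t u} → t ≃ u → sub σ t ≃ sub σ u
  sub-≃ σ = gmap (sub σ) (sub-↪ σ)

  shift-≃ : ∀ {t u} → t ≃ u → shift t ≃ shift u
  shift-≃ {t} {u} t≃u = subst₂ _≃_ (sym (ren-as-sub suc t)) (sym (ren-as-sub suc u)) (sub-≃ _ t≃u)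

  ≃-sym : ∀ {t u} → t ≃ u → u ≃ t
  ≃-sym = symmetric _↪_

  ProductCompatible : Set
  ProductCompatible = ∀ {A B A′ B′} → pi A B ≃ pi A′ B′ → (A ≃ A′) × (B ≃ B′)

  confluent⇒≃-joinable : Confluent → ∀ {t u} → t ≃ u → ∃ λ w → (t ↪* w) × (u ↪* w)
  confluent⇒≃-joinable conf ε = _ , ε , ε
  confluent⇒≃-joinable conf (fwd s ◅ r) with confluent⇒≃-joinable conf r
  ... | w , p , q = w , s ◅ p , q
  confluent⇒≃-joinable conf (bwd s ◅ r) with confluent⇒≃-joinable conf r
  ... | w , p , q with conf (s ◅ ε) p
  ... | v , p′ , q′ = v , p′ , q ◅◅ q′

  pattern-instance-≢pi : ∀ {l} → Pattern l → ∀ σ {A B} → sub σ l ≢ pi A B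
  pattern-instance-≢pi (f , ts , refl , _) σ eq =
    apps-≢pi (λ ()) (map (sub σ) ts) (trans (sym (sub-apps σ (fun f) ts)) eq)

  module _ (lhs-pattern : ∀ {l r} → Rules l r → Pattern l) where

    pi-↪ : ∀ {t u A B} → t ↪ u → t ≡ pi A B →
           ∃₂ λ A′ B′ → (u ≡ pi A′ B′) × (A ↪* A′) × (B ↪* B′)
    pi-↪ (rule lr σ) eq = ⊥-elim (pattern-instance-≢pi (lhs-pattern lr) σ eq)
    pi-↪ (beta _ _ _) ()
    pi-↪ (lamₗ _ _)   ()
    pi-↪ (lamᵣ _ _)   ()
    pi-↪ (appₗ _ _)   ()
    pi-↪ (appᵣ _ _)   ()
    pi-↪ (piₗ B s)    refl = _ , _ , refl , s ◅ ε , ε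
    pi-↪ (piᵣ A s)    refl = _ , _ , refl , ε , s ◅ ε

    pi-↪* : ∀ {A B u} → pi A B ↪* u → ∃₂ λ A′ B′ → (u ≡ pi A′ B′) × (A ↪* A′) × (B ↪* B′)
    pi-↪* ε = _ , _ , refl , ε , ε
    pi-↪* (s ◅ r) with pi-↪ s refl
    ... | _ , _ , refl , p , q with pi-↪* r
    ... | A′ , B′ , eq , p′ , q′ = A′ , B′ , eq , p ◅◅ p′ , q ◅◅ q′

    confluent⇒product-compatible : Confluent → ProductCompatible
    confluent⇒product-compatible conf c with confluent⇒≃-joinable conf c
    ... | _ , p , q with pi-↪* p | pi-↪* q
    ... | _ , _ , refl , pA , pB | _ , _ , refl , qA , qB =
      a—↠b⇒a↔b pA ◅◅ a—↠b⇒b↔a qA , a—↠b⇒a↔b pB ◅◅ a—↠b⇒b↔a qB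

  ⊢-cast : ∀ {Γ Γ′ t t′ T T′} → Γ ≡ Γ′ → t ≡ t′ → T ≡ T′ → Γ ⊢ t ∶ T → Γ′ ⊢ t′ ∶ T′
  ⊢-cast refl refl refl ⊢t = ⊢t

  ⊢-castᵀ : ∀ {Γ t T T′} → T ≡ T′ → Γ ⊢ t ∶ T → Γ ⊢ t ∶ T′
  ⊢-castᵀ = ⊢-cast refl refl

  ⊢-scoped : ∀ {Γ t T} → Γ ⊢ t ∶ T → Scoped (length Γ) t × Scoped (length Γ) T
  ⊢-scoped ax           = sort _ , sort _
  ⊢-scoped (fun f ⊢Θ)   = fun f , proj₁ (⊢-scoped ⊢Θ)
  ⊢-scoped (var ⊢A)     = var z<s , ren-scoped s<s (proj₁ (⊢-scoped ⊢A))
  ⊢-scoped (weak ⊢t _)  = let t-sc , T-sc = ⊢-scoped ⊢t in ren-scoped s<s t-sc , ren-scoped s<s T-sc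
  ⊢-scoped (prod ⊢A ⊢B) = pi (proj₁ (⊢-scoped ⊢A)) (proj₁ (⊢-scoped ⊢B)) , sort _
  ⊢-scoped (appl ⊢t ⊢a) with ⊢-scoped ⊢t | proj₁ (⊢-scoped ⊢a)
  ... | t-sc , pi _ B-sc | a-sc = app t-sc a-sc , sub-scoped inst-sc B-sc
    where
      inst-sc : ∀ {x} → x < suc _ → Scoped _ (inst (_ ∷ []) x)
      inst-sc {zero}  p       = a-sc
      inst-sc {suc x} (s<s p) = var p
  ⊢-scoped (abs ⊢b ⊢Π) with ⊢-scoped ⊢Π
  ... | pi A-sc B-sc , _ = lam A-sc (proj₁ (⊢-scoped ⊢b)) , pi A-sc B-sc
  ⊢-scoped (conv ⊢t ⊢U _) = proj₁ (⊢-scoped ⊢t) , proj₁ (⊢-scoped ⊢U)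

  infix 4 _∋_∶_
  data _∋_∶_ : Ctx → ℕ → Tm → Set where
    here  : ∀ {A Γ} → (A ∷ Γ) ∋ zero ∶ shift A
    there : ∀ {A Γ x T} → Γ ∋ x ∶ T → (A ∷ Γ) ∋ suc x ∶ shift T

  ∋-functional : ∀ {Γ x T T′} → Γ ∋ x ∶ T → Γ ∋ x ∶ T′ → T ≡ T′
  ∋-functional here      here       = refl
  ∋-functional (there l) (there l′) = cong shift (∋-functional l l′)

  WfCtx : Ctx → Set
  WfCtx Γ = ∃₂ λ t T → Γ ⊢ t ∶ T

  ⊢-ctx-head : ∀ {A Γ t T} → (A ∷ Γ) ⊢ t ∶ T → ∃ λ s → Γ ⊢ A ∶ sort s
  ⊢-ctx-head (var ⊢A)      = _ , ⊢A
  ⊢-ctx-head (weak _ ⊢A)   = _ , ⊢A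
  ⊢-ctx-head (prod ⊢A _)   = ⊢-ctx-head ⊢A
  ⊢-ctx-head (appl ⊢t _)   = ⊢-ctx-head ⊢t
  ⊢-ctx-head (abs _ ⊢Π)    = ⊢-ctx-head ⊢Π
  ⊢-ctx-head (conv ⊢t _ _) = ⊢-ctx-head ⊢t

  ⊢-weaken-closed : ∀ {Γ t T} → WfCtx Γ → [] ⊢ t ∶ T → Γ ⊢ t ∶ T
  ⊢-weaken-closed {[]}    _  ⊢t = ⊢t
  ⊢-weaken-closed {A ∷ Γ} (_ , _ , ⊢u) ⊢t with ⊢-scoped ⊢t | ⊢-ctx-head ⊢u
  ... | t-sc , T-sc | _ , ⊢A =
    ⊢-cast refl (shift-closed t-sc) (shift-closed T-sc) (weak (⊢-weaken-closed (_ , _ , ⊢A) ⊢t) ⊢A)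

  ⊢-lookup : ∀ {Γ x T} → WfCtx Γ → Γ ∋ x ∶ T → Γ ⊢ var x ∶ T
  ⊢-lookup (_ , _ , ⊢u) here      = var (proj₂ (⊢-ctx-head ⊢u))
  ⊢-lookup (_ , _ , ⊢u) (there l) =
    let _ , ⊢A = ⊢-ctx-head ⊢u in weak (⊢-lookup (_ , _ , ⊢A) l) ⊢A

  ⊢pi⇒⊢domain : ∀ {Γ t X A B} → Γ ⊢ t ∶ X → t ≡ pi A B → Γ ⊢ A ∶ ⋆
  ⊢pi⇒⊢domain ax                        ()
  ⊢pi⇒⊢domain (fun _ _)                 ()
  ⊢pi⇒⊢domain (var _)                   ()
  ⊢pi⇒⊢domain (weak {t = sort _} _ _)   ()
  ⊢pi⇒⊢domain (weak {t = var _} _ _)    ()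
  ⊢pi⇒⊢domain (weak {t = fun _} _ _)    ()
  ⊢pi⇒⊢domain (weak {t = lam _ _} _ _)  ()
  ⊢pi⇒⊢domain (weak {t = app _ _} _ _)  ()
  ⊢pi⇒⊢domain (weak {t = pi _ _} ⊢Π ⊢C) refl = weak (⊢pi⇒⊢domain ⊢Π refl) ⊢C
  ⊢pi⇒⊢domain (prod ⊢A _)               refl = ⊢A
  ⊢pi⇒⊢domain (appl _ _)                ()
  ⊢pi⇒⊢domain (abs _ _)                 ()
  ⊢pi⇒⊢domain (conv ⊢Π _ _)             eq = ⊢pi⇒⊢domain ⊢Π eq

  infix 4 _⊩_∶_
  record _⊩_∶_ (Γ : Ctx) (σ : ℕ → Tm) (Δ : Ctx) : Set where
    field
      ⊩-lookup : ∀ {x T} → Δ ∋ x ∶ T → Γ ⊢ σ x ∶ sub σ T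
      ⊩-wf     : WfCtx Γ
  open _⊩_∶_

  ⊩-lift : ∀ {Γ σ Δ A s} → Γ ⊩ σ ∶ Δ → Γ ⊢ sub σ A ∶ sort s → (sub σ A ∷ Γ) ⊩ liftₛ σ ∶ (A ∷ Δ)
  ⊩-lift {σ = σ} ⊩σ ⊢σA = record { ⊩-lookup = lookup ; ⊩-wf = _ , _ , var ⊢σA }
    where
      lookup : ∀ {x T} → (_ ∷ _) ∋ x ∶ T → _ ⊢ liftₛ σ x ∶ sub (liftₛ σ) T
      lookup (here {A})         = ⊢-castᵀ (sym (liftₛ-shift σ A)) (var ⊢σA)
      lookup (there {T = T} l)  = ⊢-castᵀ (sym (liftₛ-shift σ T)) (weak (⊩-lookup ⊩σ l) ⊢σA)

  ⊢-sub : ∀ {Γ σ Δ t T} → Γ ⊩ σ ∶ Δ → Δ ⊢ t ∶ T → Γ ⊢ sub σ t ∶ sub σ T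
  ⊢-sub ⊩σ ax = ⊢-weaken-closed (⊩-wf ⊩σ) ax
  ⊢-sub ⊩σ (fun f ⊢Θ) =
    ⊢-castᵀ (sym (sub-closed (proj₁ (⊢-scoped ⊢Θ)))) (⊢-weaken-closed (⊩-wf ⊩σ) (fun f ⊢Θ))
  ⊢-sub ⊩σ (var _) = ⊩-lookup ⊩σ here
  ⊢-sub {σ = σ} ⊩σ (weak {t = t} {T = T} ⊢t _) =
    ⊢-cast refl (sym (sub-ren suc σ t)) (sym (sub-ren suc σ T)) (⊢-sub ⊩σ∘suc ⊢t)
    where
      ⊩σ∘suc : _ ⊩ σ ∘ suc ∶ _
      ⊩σ∘suc = record
        { ⊩-lookup = λ {_} {T′} l → ⊢-castᵀ (sub-ren suc σ T′) (⊩-lookup ⊩σ (there l))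
        ; ⊩-wf     = ⊩-wf ⊩σ }
  ⊢-sub ⊩σ (prod ⊢A ⊢B) = let ⊢σA = ⊢-sub ⊩σ ⊢A in prod ⊢σA (⊢-sub (⊩-lift ⊩σ ⊢σA) ⊢B)
  ⊢-sub {σ = σ} ⊩σ (appl {a = a} {B = B} ⊢t ⊢a) =
    ⊢-castᵀ (sym (sub-[0≔] σ B a)) (appl (⊢-sub ⊩σ ⊢t) (⊢-sub ⊩σ ⊢a))
  ⊢-sub ⊩σ (abs ⊢b ⊢Π) =
    let ⊢σΠ = ⊢-sub ⊩σ ⊢Π in abs (⊢-sub (⊩-lift ⊩σ (⊢pi⇒⊢domain ⊢σΠ refl)) ⊢b) ⊢σΠ
  ⊢-sub {σ = σ} ⊩σ (conv ⊢t ⊢U T≃U) = conv (⊢-sub ⊩σ ⊢t) (⊢-sub ⊩σ ⊢U) (sub-≃ σ T≃U)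

  ⊩-shift : ∀ {Γ C s} → Γ ⊢ C ∶ sort s → (C ∷ Γ) ⊩ (λ x → var (suc x)) ∶ Γ
  ⊩-shift ⊢C = record
    { ⊩-lookup = λ {_} {T} l → ⊢-castᵀ (ren-as-sub suc T) (weak (⊢-lookup (_ , _ , ⊢C) l) ⊢C)
    ; ⊩-wf     = _ , _ , var ⊢C }

  ⊩-inst : ∀ {Γ a A} → Γ ⊢ a ∶ A → Γ ⊩ inst (a ∷ []) ∶ (A ∷ Γ)
  ⊩-inst {a = a} ⊢a = record { ⊩-lookup = lookup ; ⊩-wf = _ , _ , ⊢a }
    where
      lookup : ∀ {x T} → (_ ∷ _) ∋ x ∶ T → _ ⊢ inst (a ∷ []) x ∶ T [0≔ a ]
      lookup (here {A})         = ⊢-castᵀ (sym ([0≔]-shift a A)) ⊢a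
      lookup (there {T = T} l)  = ⊢-castᵀ (sym ([0≔]-shift a T)) (⊢-lookup (_ , _ , ⊢a) l)

  ⊢-weaken-under : ∀ {Γ A b B C s} → (A ∷ Γ) ⊢ b ∶ B → Γ ⊢ C ∶ sort s →
                   (shift A ∷ C ∷ Γ) ⊢ ren (liftᵣ {F} suc) b ∶ ren (liftᵣ {F} suc) B
  ⊢-weaken-under {A = A} {b} {B} ⊢b ⊢C =
    let _ , ⊢A = ⊢-ctx-head ⊢b
        ⊩shift = ⊩-shift ⊢C
    in ⊢-cast (cong (_∷ _) (sym (ren-as-sub suc A))) (sym (liftᵣ-ren-as-sub suc b))
              (sym (liftᵣ-ren-as-sub suc B)) (⊢-sub (⊩-lift ⊩shift (⊢-sub ⊩shift ⊢A)) ⊢b)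

  Generation : Ctx → Tm → Tm → Set
  Generation Γ (sort star) X = □ ≃ X
  Generation Γ (sort box)  X = ⊥
  Generation Γ (var x)     X = ∃ λ T → (Γ ∋ x ∶ T) × (T ≃ X)
  -- Keeping the premise of the rule fun is what makes Θ f closed under
  -- weakening.
  Generation Γ (fun f)     X = ([] ⊢ Θ f ∶ sort (Σₛ f)) × (Θ f ≃ X)
  Generation Γ (lam A b)   X = ∃ λ B → ((A ∷ Γ) ⊢ b ∶ B) × (pi A B ≃ X)
  Generation Γ (app t a)   X = ∃₂ λ A B → (Γ ⊢ t ∶ pi A B) × (Γ ⊢ a ∶ A) × (B [0≔ a ] ≃ X)
  Generation Γ (pi A B)    X = ∃ λ s → ((A ∷ Γ) ⊢ B ∶ sort s) × (sort s ≃ X)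

  generation-conv : ∀ {Γ} t {T U} → Generation Γ t T → T ≃ U → Generation Γ t U
  generation-conv (sort star) c                     T≃U = c ◅◅ T≃U
  generation-conv (var x)     (_ , l , c)           T≃U = _ , l , c ◅◅ T≃U
  generation-conv (fun f)     (⊢Θ , c)              T≃U = ⊢Θ , c ◅◅ T≃U
  generation-conv (lam A b)   (_ , ⊢b , c)          T≃U = _ , ⊢b , c ◅◅ T≃U
  generation-conv (app t a)   (_ , _ , ⊢t , ⊢a , c) T≃U = _ , _ , ⊢t , ⊢a , c ◅◅ T≃U
  generation-conv (pi A B)    (_ , ⊢B , c)          T≃U = _ , ⊢B , c ◅◅ T≃U

  generation-weaken : ∀ {Γ C s} t {T} → Γ ⊢ C ∶ sort s →
                      Generation Γ t T → Generation (C ∷ Γ) (shift t) (shift T)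
  generation-weaken (sort star) ⊢C c            = shift-≃ c
  generation-weaken (var x)     ⊢C (_ , l , c)  = _ , there l , shift-≃ c
  generation-weaken (fun f)     ⊢C (⊢Θ , c)     =
    ⊢Θ , subst (_≃ _) (shift-closed (proj₁ (⊢-scoped ⊢Θ))) (shift-≃ c)
  generation-weaken (lam A b)   ⊢C (_ , ⊢b , c) = _ , ⊢-weaken-under ⊢b ⊢C , shift-≃ c
  generation-weaken (app t a)   ⊢C (_ , B , ⊢t , ⊢a , c) =
    _ , _ , weak ⊢t ⊢C , weak ⊢a ⊢C , subst (_≃ _) (shift-[0≔] B a) (shift-≃ c)
  generation-weaken (pi A B)    ⊢C (_ , ⊢B , c) = _ , ⊢-weaken-under ⊢B ⊢C , shift-≃ c

  generation : ∀ {Γ t X} → Γ ⊢ t ∶ X → Generation Γ t X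
  generation ax                      = ε
  generation (fun f ⊢Θ)              = ⊢Θ , ε
  generation (var _)                 = _ , here , ε
  generation (weak {t = t} ⊢t ⊢C)    = generation-weaken t ⊢C (generation ⊢t)
  generation (prod _ ⊢B)             = _ , ⊢B , ε
  generation (appl ⊢t ⊢a)            = _ , _ , ⊢t , ⊢a , ε
  generation (abs ⊢b _)              = _ , ⊢b , ε
  generation (conv {t = t} ⊢t _ T≃U) = generation-conv t (generation ⊢t) T≃U

  ⊢-apps-head : ∀ {Γ t T} as → Γ ⊢ apps t as ∶ T → ∃ λ X → Γ ⊢ t ∶ X
  ⊢-apps-head []       ⊢t = _ , ⊢t
  ⊢-apps-head (a ∷ as) ⊢t·as with generation (proj₂ (⊢-apps-head as ⊢t·as))
  ... | _ , _ , ⊢t , _ = _ , ⊢t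

  ⊢-validity : ∀ {Γ t T} → Γ ⊢ t ∶ T → (T ≡ □) ⊎ (∃ λ s → Γ ⊢ T ∶ sort s)
  ⊢-validity ax         = inj₁ refl
  ⊢-validity (fun f ⊢Θ) = inj₂ (_ , ⊢Θ)
  ⊢-validity (var ⊢A)   = inj₂ (_ , weak ⊢A ⊢A)
  ⊢-validity (weak ⊢t ⊢C) with ⊢-validity ⊢t
  ... | inj₁ refl     = inj₁ refl
  ... | inj₂ (_ , ⊢T) = inj₂ (_ , weak ⊢T ⊢C)
  ⊢-validity (prod {s = box}  _ _)  = inj₁ refl
  ⊢-validity (prod {s = star} ⊢A _) = inj₂ (_ , ⊢-weaken-closed (_ , _ , ⊢A) ax)
  ⊢-validity (appl ⊢t ⊢a) with ⊢-validity ⊢t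
  ... | inj₂ (_ , ⊢Π) = let _ , ⊢B , _ = generation ⊢Π in inj₂ (_ , ⊢-sub (⊩-inst ⊢a) ⊢B)
  ⊢-validity (abs _ ⊢Π)    = inj₂ (_ , ⊢Π)
  ⊢-validity (conv _ ⊢U _) = inj₂ (_ , ⊢U)

  ⊢∶pi⇒⊢domain : ∀ {Γ t A B} → Γ ⊢ t ∶ pi A B → Γ ⊢ A ∶ ⋆
  ⊢∶pi⇒⊢domain ⊢t with ⊢-validity ⊢t
  ... | inj₂ (_ , ⊢Π) = ⊢pi⇒⊢domain ⊢Π refl

  module _ (product-compatible : ProductCompatible) where

    mutual
      generation-unique : ∀ {Γ} t {X Y} → Generation Γ t X → Generation Γ t Y → X ≃ Y
      generation-unique (sort star) c c′ = ≃-sym c ◅◅ c′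
      generation-unique (var x) (_ , l , c) (_ , l′ , c′) rewrite ∋-functional l l′ =
        ≃-sym c ◅◅ c′
      generation-unique (fun f) (_ , c) (_ , c′) = ≃-sym c ◅◅ c′
      generation-unique (lam A b) (_ , ⊢b , c) (_ , ⊢b′ , c′) =
        ≃-sym c ◅◅ gmap (pi A) (piᵣ A) (type-unique ⊢b ⊢b′) ◅◅ c′
      generation-unique (app t a) (_ , _ , ⊢t , _ , c) (_ , _ , ⊢t′ , _ , c′) =
        ≃-sym c ◅◅ sub-≃ (inst (a ∷ [])) (proj₂ (product-compatible (type-unique ⊢t ⊢t′))) ◅◅ c′
      generation-unique (pi A B) (_ , ⊢B , c) (_ , ⊢B′ , c′) =
        ≃-sym c ◅◅ type-unique ⊢B ⊢B′ ◅◅ c′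

      type-unique : ∀ {Γ t X Y} → Γ ⊢ t ∶ X → Γ ⊢ t ∶ Y → X ≃ Y
      type-unique {t = t} ⊢t ⊢t′ = generation-unique t (generation ⊢t) (generation ⊢t′)

    ⊢-argument : ∀ {Γ t a A B X} → Γ ⊢ t ∶ pi A B → Γ ⊢ app t a ∶ X → Γ ⊢ a ∶ A
    ⊢-argument ⊢t ⊢ta with generation ⊢ta
    ... | _ , _ , ⊢t′ , ⊢a , _ =
      conv ⊢a (⊢∶pi⇒⊢domain ⊢t) (proj₁ (product-compatible (type-unique ⊢t′ ⊢t)))

    ⊢-apps-instance : ∀ {Γ n} acc t (Ts : Vec Tm n) U T (as : Vec Tm n) →
      Γ ⊢ t ∶ sub (inst acc) (Pis Ts U) → Γ ⊢ apps t (toList as) ∶ T →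
      (sub (inst (reverseAcc acc (toList as))) U ≃ T) × WtSubAux Γ acc as Ts
    ⊢-apps-instance acc t []ᵛ U T []ᵛ ⊢t ⊢t·as = type-unique ⊢t ⊢t·as , tt
    ⊢-apps-instance acc t (T₁ ∷ᵛ Ts) U T (a ∷ᵛ as) ⊢t ⊢t·a·as =
      let ⊢a = ⊢-argument ⊢t (proj₂ (⊢-apps-head (toList as) ⊢t·a·as))
          ⊢t·a = ⊢-castᵀ (liftₛ-inst-[0≔] a acc (Pis Ts U)) (appl ⊢t ⊢a)
          Uσ≃T , ⊢as = ⊢-apps-instance (a ∷ acc) (app t a) Ts U T as ⊢t·a ⊢t·a·as
      in Uσ≃T , ⊢a , ⊢as

lemma4p5 : (Λ : Calculus) → let open Typing Λ in
    Assumptions →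
    ∀ (Γ : Ctx) (t : Tm) (n : ℕ) (Ts : Vec Tm n) (U T : Tm) (as : Vec Tm n) →
    Γ ⊢ t ∶ Pis Ts U →
    Γ ⊢ apps t (toList as) ∶ T →
    (U [ as ]ⁿ ≃ T) × (Γ ⊢ˢ as ∶ Ts)
lemma4p5 Λ asm Γ t n Ts U T as ⊢t ⊢t·as =
  ⊢-apps-instance Λ product-compatible [] t Ts U T as
    (⊢-castᵀ Λ (sym (sub-var (Pis Ts U))) ⊢t) ⊢t·as
  where
    open Typing.Assumptions asm using (confluent; lhsPat)
    product-compatible : ProductCompatible Λ
    product-compatible = confluent⇒product-compatible Λ lhsPat confluent
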